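{- Let $2\le k<g$ be integers. If there is a $(g,k)$ reverse multiple whose first and last digits sum to $g$, then $Y(g,k)$ is a 1089 graph. If $Y(g,k)$ is a 1089 graph, then every $(g,k)$ reverse multiple has first and last digits summing to $g$.
   Context: For integers $c_i$, $(c_{n-1},\dots,c_0)_g=\sum c_ig^i$. A $(g,k)$ reverse multiple is a positive integer $N=(a_{n-1},\dots,a_0)_g$ with $0\le a_i\le g-1$, $a_{n-1}\ne0$, and $kN=(a_0,a_1,\dots,a_{n-1})_g$; its first digit is $a_{n-1}$ and last digit $a_0$. The labeled directed graph $H(g,k)$ has a starting node $[[0,0]]$ and other nodes $[R,r]$, $0\le R,r\le k-1$ ($[0,0]$ distinct from the starting node); from a node $[P,p]$ (starting node treated as $[0,0]$) there is an edge labeled $(A,a)$ to $[R,r]$ whenever $0\le A,a\le g-1$, $ka+p=A+rg$, $kA+R=a+Pg$, with $A\ne0\ne a$ required for edges leaving the starting node, and no edges into the starting node; $H(g,k)$ consists of all nodes reachable from the starting node. Even pivot node: $[a,a]$; odd pivot node: $[r,s]$ with an edge to $[s,r]$; the starting node is not a pivot node. $Y(g,k)$ is obtained from $H(g,k)$ by deleting every non-pivot node from which no pivot node is reachable. A 1089 graph is a Young graph isomorphic to $Y(10,9)$ via a bijection of nodes that is an isomorphism of underlying unlabeled directed graphs and preserves even and odd pivot nodes; $Y(10,9)$ has nodes $[[0,0]],[0,8],[8,8],[8,0],[0,0]$ and edges $[[0,0]]\to[0,8]\to[8,8]\to[8,0]\to[0,0]\to[0,8]$ plus self-loops at $[8,8]$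 and $[0,0]$. -}

module Defs where

open import Data.Nat using (ℕ; zero; suc; _+_; _*_; _<_; _≤_)
open import Data.Fin using (Fin; toℕ)
open import Data.Vec using (Vec; []; _∷_; reverse; head; last)
open import Data.Vec.Relation.Unary.All using (All)
open import Data.Product using (Σ; ∃; ∃-syntax; _×_; _,_)
open import Data.Sum using (_⊎_)
open import Data.Empty using (⊥)
open import Relation.Binary.PropositionalEquality using (_≡_; _≢_)
open import Relation.Binary.Construct.Closure.ReflexiveTransitive using (Star)
open import Function.Bundles using (_⇔_)

-- Base-g values of digit strings.
-- A digit vector (d₀ ∷ d₁ ∷ … ∷ d_{n-1}) is read LITTLE-endian:
-- value g v = Σ dᵢ gⁱ, i.e. index 0 is the last (least significant) digit a₀.

value : ∀ {n} → ℕ → Vec ℕ n → ℕ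
value g []       = 0
value g (d ∷ ds) = d + g * value g ds

-- A (g,k) reverse multiple N = (a_{n-1},…,a₀)_g, stored with its digits
-- a₀ ∷ a₁ ∷ … ∷ a_{n-1} (at least one digit), leading digit nonzero,
-- and k N = (a₀,a₁,…,a_{n-1})_g.
record ReverseMultiple (g k : ℕ) : Set where
  field
    len       : ℕ
    digits    : Vec ℕ (suc len)
    N         : ℕ
    N-def     : N ≡ value g digits
    digits<g  : All (_< g) digits
    lead≢0    : last digits ≢ 0
    revMult   : k * N ≡ value g (reverse digits)

  firstDigit : ℕ
  firstDigit = last digits

  lastDigit : ℕ
  lastDigit = head digits

open ReverseMultiple public

data Node (k : ℕ) : Set where
  start : Node k                     -- the starting node [[0,0]]
  nd    : Fin k → Fin k → Node k

-- edge (labelled (A,a)) from a node with coordinates [P,p] to [R,r]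
EdgeFrom : (g k P p R r : ℕ) → Set
EdgeFrom g k P p R r =
  Σ ℕ λ A → Σ ℕ λ a →
    A < g × a < g × (k * a + p ≡ A + r * g) × (k * A + R ≡ a + P * g)

-- existence of an edge (underlying unlabelled directed graph)
Edge : (g k : ℕ) → Node k → Node k → Set
Edge g k _        start    = ⊥
Edge g k start    (nd R r) =
  Σ ℕ λ A → Σ ℕ λ a →
    A < g × a < g × A ≢ 0 × a ≢ 0 ×
    (k * a + 0 ≡ A + toℕ r * g) × (k * A + toℕ R ≡ a + 0 * g)
Edge g k (nd P p) (nd R r) = EdgeFrom g k (toℕ P) (toℕ p) (toℕ R) (toℕ r)

-- nodes of H(g,k): those reachable from the starting node
InH : (g k : ℕ) → Node k → Set
InH g k v = Star (Edge g k) start v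

EvenPivot : ∀ {k} → Node k → Set
EvenPivot start    = ⊥
EvenPivot (nd a b) = a ≡ b

OddPivot : (g k : ℕ) → Node k → Set
OddPivot g k start    = ⊥
OddPivot g k (nd r s) = Edge g k (nd r s) (nd s r)

Pivot : (g k : ℕ) → Node k → Set
Pivot g k v = EvenPivot v ⊎ OddPivot g k v

-- nodes of Y(g,k): nodes of H(g,k) that are pivots or from which a pivot
-- is reachable (reflexive reachability covers the pivot case)
InY : (g k : ℕ) → Node k → Set
InY g k v = InH g k v × (∃[ w ] (Pivot g k w × Star (Edge g k) v w))

record Is1089Graph (g k : ℕ) : Set where
  field
    to      : Node k → Node 9
    from    : Node 9 → Node k
    to-Y    : ∀ v → InY g k v → InY 10 9 (to v)
    from-Y  : ∀ w → InY 10 9 w → InY g k (from w)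
    from-to : ∀ v → InY g k v → from (to v) ≡ v
    to-from : ∀ w → InY 10 9 w → to (from w) ≡ w
    edges   : ∀ u v → InY g k u → InY g k v →
              Edge g k u v ⇔ Edge 10 9 (to u) (to v)
    even    : ∀ v → InY g k v → EvenPivot v ⇔ EvenPivot (to v)
    odd     : ∀ v → InY g k v → OddPivot g k v ⇔ OddPivot 10 9 (to v)

module Submission where

open import Defs
open import Data.Nat using (ℕ; _+_; _≤_; _<_)
open import Data.Product using (_×_; Σ-syntax)
open import Relation.Binary.PropositionalEquality using (_≡_)

open import Data.Nat
open import Data.Nat.Properties
open import Data.Nat.Divisibility
open import Data.Nat.DivMod using (_%_; _/_; m≡m%n+[m/n]*n; m%n<n; [m+kn]%n≡m%n; m<n⇒m%n≡m)
open import Data.Nat.GCD using (gcd; gcd[m,n]∣m; gcd[m,n]∣n)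
open import Data.Nat.Coprimality as Coprimality using (Coprime; gcd≡1⇒coprime; coprime-divisor)
open import Data.Nat.Induction using (<-rec)
open import Data.Nat.Tactic.RingSolver using (solve; solve-∀)
open import Data.List using () renaming ([] to []ˡ; _∷_ to _∷ˡ_)
open import Data.Bool using (Bool; true; false)
open import Data.Fin as Fin using (Fin; toℕ; fromℕ; fromℕ<)
open import Data.Fin.Properties using (toℕ≤pred[n]; toℕ-injective; toℕ-fromℕ; toℕ-fromℕ<)
open import Data.Vec using (Vec; []; _∷_; _∷ʳ_; reverse; head; last)
open import Data.Vec.Properties using (reverse-∷; reverse-involutive; last-reverse)
open import Data.Vec.Relation.Unary.All using (All; _∷_)
open import Data.Product using (Σ; ∃-syntax; _,_; proj₁; proj₂; map₂)
open import Data.Sum using (_⊎_; inj₁; inj₂)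
open import Data.Empty using (⊥; ⊥-elim)
open import Relation.Nullary using (¬_; Dec; yes; no)
open import Relation.Binary.PropositionalEquality
open import Relation.Binary.Construct.Closure.ReflexiveTransitive using (Star; ε; _◅_; _◅◅_)
open import Function using (id)
open import Function.Bundles using (mk⇔; Equivalence)

-- A reverse multiple N = (a_L, …, a₀)_g and the carries c of k·N walk through
-- H(g,k): start → [c_L, c_1] → [c_{L-1}, c_2] → … reaches a pivot in the
-- middle, and the first edge is labelled (A,a) by the first and last digit.  For g = (k+1)m every edge
-- [P,p] → [R,r] satisfies R = p and (k-1)A + p = m(r + kP); an iterated gcd
-- argument then puts all coordinates of Y in {0, k-1}, and the edge table of
-- these corner nodes shows that all such graphs are isomorphic to Y(10,9)
-- (corner-1089).  In a 1089 graph the first node of the walk is no odd pivot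
-- and has an edge to a looped even pivot (successor-structure).  Finally the
-- label arithmetic of start edges gives both implications: A + a = g forces
-- g = (k+1)A, and the structure above forces A + a = g.

residue-unique : ∀ n .{{_ : NonZero n}} {x y} q q′ → x < n → y < n →
                 x + q * n ≡ y + q′ * n → x ≡ y
residue-unique n {x} {y} q q′ x<n y<n eq = begin
  x                ≡⟨ m<n⇒m%n≡m x<n ⟨
  x % n            ≡⟨ [m+kn]%n≡m%n x q n ⟨
  (x + q * n) % n  ≡⟨ cong (_% n) eq ⟩
  (y + q′ * n) % n ≡⟨ [m+kn]%n≡m%n y q′ n ⟩
  y % n            ≡⟨ m<n⇒m%n≡m y<n ⟩
  y                ∎
  where open ≡-Reasoning

snoc-view : ∀ {I : Set} {T : I → I → Set} {a b} → Star T a b →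
            a ≡ b ⊎ ∃[ u ] (Star T a u × T u b)
snoc-view ε = inj₁ refl
snoc-view (e ◅ es) with snoc-view es
... | inj₁ refl           = inj₂ (_ , ε , e)
... | inj₂ (u , es′ , e′) = inj₂ (u , e ◅ es′ , e′)

factors-nonZero : ∀ {c e n} → c * e ≡ suc n → NonZero c × NonZero e
factors-nonZero {zero}          ()
factors-nonZero {suc c} {zero}  ce = ⊥-elim (0≢1+n (trans (sym (*-zeroʳ c)) ce))
factors-nonZero {suc c} {suc e} _  = _ , _

≢0∧≢1⇒>1 : ∀ {n} → n ≢ 0 → n ≢ 1 → 1 < n
≢0∧≢1⇒>1 {zero}        n≢0 _   = ⊥-elim (n≢0 refl)
≢0∧≢1⇒>1 {suc zero}    _   n≢1 = ⊥-elim (n≢1 refl)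
≢0∧≢1⇒>1 {suc (suc n)} _   _   = s≤s (s≤s z≤n)

halve : ∀ n → ∃[ h ] (n ≡ h + h ⊎ n ≡ suc (h + h))
halve zero = 0 , inj₁ refl
halve (suc n) with halve n
... | h , inj₁ n≡2h  = h , inj₂ (cong suc n≡2h)
... | h , inj₂ n≡2h+1 = suc h , inj₁ (cong suc (trans n≡2h+1 (sym (+-suc h h))))

module _ {g k : ℕ} where

  Y-entry : ∀ {v} → InY g k v → v ≢ start → ∃[ u ] (Edge g k u v × InY g k u)
  Y-entry (h , w , piv , s) v≢start with snoc-view h
  ... | inj₁ start≡v       = ⊥-elim (v≢start (sym start≡v))
  ... | inj₂ (u , hu , e)  = u , e , (hu , w , piv , e ◅ s)

  Y-exit : ∀ {v} → InY g k v → Pivot g k v ⊎ ∃[ t ] (Edge g k v t × InY g k t)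
  Y-exit (h , w , piv , ε)     = inj₁ piv
  Y-exit (h , w , piv , e ◅ s) = inj₂ (_ , e , (h ◅◅ e ◅ ε , w , piv , s))

  Y-induction : (Q : Node k → Set) → Q start →
                (∀ {u v} → InY g k v → Edge g k u v → Q u → Q v) →
                ∀ {v} → InY g k v → Q v
  Y-induction Q q₀ step {v} (h , w , piv , s) = walk ε h q₀
    where
      walk : ∀ {u} → InH g k u → Star (Edge g k) u v → Q u → Q v
      walk hu ε       q = q
      walk hu (e ◅ p) q = walk (hu ◅◅ e ◅ ε) p (step (hu ◅◅ e ◅ ε , w , piv , p ◅◅ s) e q)

edge-reverse : ∀ {g k P p R r} → EdgeFrom g k P p R r → EdgeFrom g k r R p P
edge-reverse (A , a , A<g , a<g , e₁ , e₂) = a , A , a<g , A<g , e₂ , e₁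

-- A start edge into [R,r] carrying the labels (A,a); an edge of H from the
-- start node into nd R r is exactly a choice of such labels for toℕ R, toℕ r.
StartLabels : (g k A a R r : ℕ) → Set
StartLabels g k A a R r =
  A < g × a < g × A ≢ 0 × a ≢ 0 × (k * a + 0 ≡ A + r * g) × (k * A + R ≡ a + 0 * g)

-- A start edge (labels A,a with a ≠ 0) never enters a node [R,0] when k ≥ 2:
-- its equations would give A = k a and a ≥ k A, so a ≥ k² a > a.
start-edge-r≢0 : ∀ {g k′ A a R} → a ≢ 0 →
                 suc (suc k′) * a + 0 ≡ A + 0 * g →
                 suc (suc k′) * A + R ≡ a + 0 * g → ⊥
start-edge-r≢0 {a = zero} a≢0 _ _ = a≢0 refl
start-edge-r≢0 {g} {k′} {A} {a@(suc _)} {R} _ e₁ e₂ =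
  <-irrefl refl (begin-strict
    a             <⟨ m<m+n a z<s ⟩
    k * a         ≤⟨ m≤n*m (k * a) k ⟩
    k * (k * a)   ≡⟨ cong (k *_) ka≡A ⟩
    k * A         ≤⟨ m≤m+n (k * A) R ⟩
    k * A + R     ≡⟨ trans e₂ (+-identityʳ a) ⟩
    a             ∎)
  where
    open ≤-Reasoning
    k : ℕ
    k = suc (suc k′)
    ka≡A : k * a ≡ A
    ka≡A = +-cancelʳ-≡ 0 _ _ e₁

-- [0,p] is never an odd pivot for p > 0: the swap edge would give
-- A = ka + p > a and a = kA + p > A.
no-swap-up : ∀ {g d p} → 0 < p → ¬ EdgeFrom g (suc d) 0 p p 0
no-swap-up {g} {d} {p} p>0 (A , a , _ , _ , e₁ , e₂) = <-asym (exceeds a A e₁) (exceeds A a e₂)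
  where
    exceeds : ∀ x y → suc d * x + p ≡ y + 0 * g → x < y
    exceeds x y e = begin-strict
      x             <⟨ m<m+n x p>0 ⟩
      x + p         ≤⟨ +-monoˡ-≤ p (m≤n*m x (suc d)) ⟩
      suc d * x + p ≡⟨ trans e (+-identityʳ y) ⟩
      y             ∎
      where open ≤-Reasoning

-- [d,0] is never an odd pivot (d = k-1 > 0): adding the two equations of the
-- swap edge gives d(a + A) = d(g + g), impossible for labels below g.
no-swap-down : ∀ {g d′} → ¬ EdgeFrom g (suc (suc d′)) (suc d′) 0 0 (suc d′)
no-swap-down {g} {d′} (A , a , A<g , a<g , e₁ , e₂) = <-irrefl labels-sum (+-mono-< a<g A<g)
  where
    open ≡-Reasoning
    labels-sum : a + A ≡ g + g
    labels-sum = *-cancelˡ-≡ _ _ (suc d′) (+-cancelˡ-≡ (a + A) _ _ (begin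
      (a + A) + suc d′ * (a + A)                 ≡⟨ solve (a ∷ˡ A ∷ˡ d′ ∷ˡ []ˡ) ⟩
      (suc (suc d′) * a + 0) + (suc (suc d′) * A + 0) ≡⟨ cong₂ _+_ e₁ e₂ ⟩
      (A + suc d′ * g) + (a + suc d′ * g)        ≡⟨ solve (a ∷ˡ A ∷ˡ d′ ∷ˡ g ∷ˡ []ˡ) ⟩
      (a + A) + suc d′ * (g + g)                 ∎))

-- Digit i of a little-endian digit vector (0 beyond its length).
digit : ∀ {n} → Vec ℕ n → ℕ → ℕ
digit []       _       = 0
digit (x ∷ xs) zero    = x
digit (x ∷ xs) (suc i) = digit xs i

digit-All : ∀ {P : ℕ → Set} {n} {v : Vec ℕ n} → All P v → ∀ {i} → i < n → P (digit v i)
digit-All (px ∷ _)   {zero}  _         = px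
digit-All (_  ∷ pxs) {suc i} (s≤s i<n) = digit-All pxs i<n

digit-∷ʳ-< : ∀ {n} (xs : Vec ℕ n) x {i} → i < n → digit (xs ∷ʳ x) i ≡ digit xs i
digit-∷ʳ-< (y ∷ ys) x {zero}  _         = refl
digit-∷ʳ-< (y ∷ ys) x {suc i} (s≤s i<n) = digit-∷ʳ-< ys x i<n

digit-∷ʳ-≡ : ∀ {n} (xs : Vec ℕ n) x → digit (xs ∷ʳ x) n ≡ x
digit-∷ʳ-≡ []       x = refl
digit-∷ʳ-≡ (y ∷ ys) x = digit-∷ʳ-≡ ys x

digit-reverse : ∀ {n} (v : Vec ℕ (suc n)) {i} → i ≤ n → digit (reverse v) i ≡ digit v (n ∸ i)
digit-reverse {zero}  (x ∷ []) {zero} _ = refl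
digit-reverse {suc n} (x ∷ xs) {i} i≤n rewrite reverse-∷ x xs with i ≟ suc n
... | yes refl = trans (digit-∷ʳ-≡ (reverse xs) x) (cong (digit (x ∷ xs)) (sym (n∸n≡0 n)))
... | no  i≢n  = begin
  digit (reverse xs ∷ʳ x) i ≡⟨ digit-∷ʳ-< (reverse xs) x i<n ⟩
  digit (reverse xs) i      ≡⟨ digit-reverse xs (≤-pred i<n) ⟩
  digit xs (n ∸ i)          ≡⟨ cong (digit (x ∷ xs)) (+-∸-assoc 1 (≤-pred i<n)) ⟨
  digit (x ∷ xs) (suc n ∸ i) ∎
  where
    open ≡-Reasoning
    i<n : i < suc n
    i<n = ≤∧≢⇒< i≤n i≢n

head-digit : ∀ {n} (v : Vec ℕ (suc n)) → head v ≡ digit v 0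
head-digit (x ∷ _) = refl

last-digit : ∀ {n} (v : Vec ℕ (suc n)) → last v ≡ digit v n
last-digit {n} v = begin
  last v                     ≡⟨ cong last (reverse-involutive v) ⟨
  last (reverse (reverse v)) ≡⟨ last-reverse (reverse v) ⟩
  head (reverse v)           ≡⟨ head-digit (reverse v) ⟩
  digit (reverse v) 0        ≡⟨ digit-reverse v z≤n ⟩
  digit v n                  ∎
  where
    open ≡-Reasoning

column-step : ∀ {g′ k} a₀ b₀ c₀ va vb → a₀ < suc g′ → b₀ < suc g′ → c₀ < k →
              k * (a₀ + suc g′ * va) + c₀ ≡ b₀ + suc g′ * vb →
              ∃[ c₁ ] (c₁ < k × k * a₀ + c₀ ≡ b₀ + suc g′ * c₁ × k * va + c₁ ≡ vb)
column-step {g′} {k} a₀ b₀ c₀ va vb a₀<g b₀<g c₀<k eq = c₁ , c₁<k , column , rest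
  where
    g X c₁ : ℕ
    g  = suc g′
    X  = k * a₀ + c₀
    c₁ = X / g
    split : X % g + (c₁ + k * va) * g ≡ b₀ + vb * g
    split = begin
      X % g + (c₁ + k * va) * g       ≡⟨ regroup (X % g) c₁ (k * va) g ⟩
      (X % g + c₁ * g) + k * va * g   ≡⟨ cong (_+ k * va * g) (m≡m%n+[m/n]*n X g) ⟨
      X + k * va * g                  ≡⟨ expand k a₀ c₀ va g ⟩
      k * (a₀ + g * va) + c₀          ≡⟨ eq ⟩
      b₀ + g * vb                     ≡⟨ cong (b₀ +_) (*-comm g vb) ⟩
      b₀ + vb * g                     ∎
      where
        open ≡-Reasoning
        regroup : ∀ r q t g → r + (q + t) * g ≡ (r + q * g) + t * g
        regroup = solve-∀
        expand : ∀ k a c v g → k * a + c + k * v * g ≡ k * (a + g * v) + c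
        expand = solve-∀
    X%g≡b₀ : X % g ≡ b₀
    X%g≡b₀ = residue-unique g (c₁ + k * va) vb (m%n<n X g) b₀<g split
    column : X ≡ b₀ + g * c₁
    column = trans (m≡m%n+[m/n]*n X g) (cong₂ _+_ X%g≡b₀ (*-comm c₁ g))
    rest : k * va + c₁ ≡ vb
    rest = trans (+-comm (k * va) c₁)
             (*-cancelʳ-≡ _ _ g (+-cancelˡ-≡ b₀ _ _
               (subst (λ x → x + (c₁ + k * va) * g ≡ b₀ + vb * g) X%g≡b₀ split)))
    X<kg : X < k * g
    X<kg = begin-strict
      k * a₀ + c₀ <⟨ +-mono-≤-< (*-monoʳ-≤ k (≤-pred a₀<g)) c₀<k ⟩
      k * g′ + k  ≡⟨ +-comm (k * g′) k ⟩
      k + k * g′  ≡⟨ *-suc k g′ ⟨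
      k * g       ∎
      where open ≤-Reasoning
    c₁<k : c₁ < k
    c₁<k = *-cancelʳ-< g c₁ k (≤-<-trans c₁g≤X X<kg)
      where
        c₁g≤X : c₁ * g ≤ X
        c₁g≤X = subst (c₁ * g ≤_) (sym (trans column (cong (b₀ +_) (*-comm g c₁)))) (m≤n+m (c₁ * g) b₀)

record Carries (g k : ℕ) {n} (as bs : Vec ℕ n) (c₀ : ℕ) : Set where
  field
    carry       : ℕ → ℕ
    carry-first : carry 0 ≡ c₀
    carry-last  : carry n ≡ 0
    carry<k     : ∀ i → carry i < k
    column      : ∀ {i} → i < n → k * digit as i + carry i ≡ digit bs i + g * carry (suc i)

carries : ∀ {g′ k n} (as bs : Vec ℕ n) {c₀} →
          (∀ {i} → i < n → digit as i < suc g′) → (∀ {i} → i < n → digit bs i < suc g′) →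
          c₀ < k → k * value (suc g′) as + c₀ ≡ value (suc g′) bs → Carries (suc g′) k as bs c₀
carries {k = k} [] [] {c₀} _ _ c₀<k eq = record
  { carry       = λ _ → 0
  ; carry-first = sym (trans (sym (cong (_+ c₀) (*-zeroʳ k))) eq)
  ; carry-last  = refl
  ; carry<k     = λ _ → ≤-<-trans z≤n c₀<k
  ; column      = λ ()
  }
carries {g′} {k} (a₀ ∷ as) (b₀ ∷ bs) {c₀} as<g bs<g c₀<k eq
  with column-step {g′} {k} a₀ b₀ c₀ (value (suc g′) as) (value (suc g′) bs) (as<g z<s) (bs<g z<s) c₀<k eq
... | c₁ , c₁<k , column₀ , eq′ = record
  { carry       = carry
  ; carry-first = refl
  ; carry-last  = Rest.carry-last
  ; carry<k     = carry<k
  ; column      = column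
  }
  where
    module Rest = Carries (carries as bs (λ i<n → as<g (s≤s i<n)) (λ i<n → bs<g (s≤s i<n)) c₁<k eq′)
    carry : ℕ → ℕ
    carry zero    = c₀
    carry (suc i) = Rest.carry i
    carry<k : ∀ i → carry i < k
    carry<k zero    = c₀<k
    carry<k (suc i) = Rest.carry<k i
    column : ∀ {i} → i < suc _ →
             k * digit (a₀ ∷ as) i + carry i ≡ digit (b₀ ∷ bs) i + suc g′ * carry (suc i)
    column {zero}  _         = trans column₀ (cong (λ c → b₀ + suc g′ * c) (sym Rest.carry-first))
    column {suc i} (s≤s i<n) = Rest.column i<n

-- The walk of a reverse multiple N = (a_L, …, a₀)_g through H(g,k), with
-- c the carries of k N = (a₀, …, a_L)_g: node j is [c(n-j), c(j)] (n = L+1),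
-- node 0 plays the role of the start node, and columns j and L-j of the
-- multiplication form the edge from node j to node j+1, labelled (a(L-j), a(j)).
module Walk {g′ k′ : ℕ} (M : ReverseMultiple (suc g′) (suc (suc k′))) where
  private
    module M = ReverseMultiple M

  g k L n : ℕ
  g = suc g′
  k = suc (suc k′)
  L = M.len
  n = suc L

  a : ℕ → ℕ
  a = digit M.digits

  a<g : ∀ {i} → i < n → a i < g
  a<g = digit-All M.digits<g

  reversed : ∀ {i} → i ≤ L → digit (reverse M.digits) i ≡ a (L ∸ i)
  reversed = digit-reverse M.digits

  product : Carries g k M.digits (reverse M.digits) 0
  product = carries M.digits (reverse M.digits) a<g reversed<g z<s k·N
    where
      reversed<g : ∀ {i} → i < n → digit (reverse M.digits) i < g
      reversed<g {i} i<n = subst (_< g) (sym (reversed (≤-pred i<n))) (a<g (s≤s (m∸n≤m L i)))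
      k·N : k * value g M.digits + 0 ≡ value g (reverse M.digits)
      k·N = trans (+-identityʳ _) (trans (cong (k *_) (sym M.N-def)) M.revMult)

  open Carries product

  column-j : ∀ {j} → j ≤ L → k * a j + carry j ≡ a (L ∸ j) + carry (suc j) * g
  column-j j≤L = trans (column (s≤s j≤L)) (cong₂ _+_ (reversed j≤L) (*-comm g _))

  column-mirror : ∀ {j} → j ≤ L → k * a (L ∸ j) + carry (L ∸ j) ≡ a j + carry (n ∸ j) * g
  column-mirror {j} j≤L = trans (column (s≤s (m∸n≤m L j)))
    (cong₂ _+_ (trans (reversed (m∸n≤m L j)) (cong a (m∸[m∸n]≡n j≤L)))
               (trans (*-comm g _) (cong (λ i → carry i * g) (sym (+-∸-assoc 1 j≤L)))))

  node′ : ℕ → ℕ → Node k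
  node′ i j = nd (fromℕ< (carry<k i)) (fromℕ< (carry<k j))

  node : ℕ → Node k
  node j = node′ (n ∸ j) j

  edge : ∀ {j} → j ≤ L → Edge g k (node j) (node (suc j))
  edge {j} j≤L
    rewrite toℕ-fromℕ< (carry<k (n ∸ j)) | toℕ-fromℕ< (carry<k j)
          | toℕ-fromℕ< (carry<k (L ∸ j)) | toℕ-fromℕ< (carry<k (suc j)) =
    a (L ∸ j) , a j , a<g (s≤s (m∸n≤m L j)) , a<g (s≤s j≤L) , column-j j≤L , column-mirror j≤L

  ascend : ∀ t → t ≤ L → Star (Edge g k) (node 1) (node (suc t))
  ascend zero    _  = ε
  ascend (suc t) le = ascend t (≤-trans (n≤1+n t) le) ◅◅ (_◅_ {j = node (suc (suc t))} (edge le) ε)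

  -- A single digit cannot form a reverse multiple: k a₀ = a₀ forces a₀ = 0.
  several-digits : L ≢ 0
  several-digits L≡0 = M.lead≢0 (trans (last-digit M.digits) (trans (cong a L≡0) a₀≡0))
    where
      open ≡-Reasoning
      ka₀≡a₀ : a 0 + suc k′ * a 0 ≡ a 0 + 0
      ka₀≡a₀ = begin
        a 0 + suc k′ * a 0         ≡⟨ +-identityʳ _ ⟨
        k * a 0 + 0                ≡⟨ cong (k * a 0 +_) carry-first ⟨
        k * a 0 + carry 0          ≡⟨ column-j z≤n ⟩
        a L + carry 1 * g          ≡⟨ cong₂ (λ i j → a i + carry (suc j) * g) L≡0 (sym L≡0) ⟩
        a 0 + carry n * g          ≡⟨ cong (λ c → a 0 + c * g) carry-last ⟩
        a 0 + 0                    ∎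
      a₀≡0 : a 0 ≡ 0
      a₀≡0 with m*n≡0⇒m≡0∨n≡0 (suc k′) (+-cancelˡ-≡ (a 0) _ _ ka₀≡a₀)
      ... | inj₂ a₀≡0 = a₀≡0

  -- The middle of the walk is a pivot: for n = 2h+1 node h is an odd pivot,
  -- for n = 2h+2 node h+1 is an even pivot.
  middle : ∃[ w ] (Pivot g k w × Star (Edge g k) (node 1) w)
  middle with halve L
  ... | zero , inj₁ L≡0 = ⊥-elim (several-digits L≡0)
  ... | suc h′ , inj₁ L≡2h = node (suc h′) , inj₂ odd , ascend h′ (≤-trans (n≤1+n h′) h≤L)
    where
      h : ℕ
      h = suc h′
      h≤L : h ≤ L
      h≤L = subst (h ≤_) (sym L≡2h) (m≤m+n h h)
      L∸h≡h : L ∸ h ≡ h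
      L∸h≡h = trans (cong (_∸ h) L≡2h) (m+n∸n≡m h h)
      odd : Edge g k (node h) (node′ h (n ∸ h))
      odd = subst₂ (λ i j → Edge g k (node h) (node′ i j)) L∸h≡h
                   (sym (trans (+-∸-assoc 1 h≤L) (cong suc L∸h≡h))) (edge h≤L)
  ... | h , inj₂ L≡2h+1 = node (suc h) , inj₁ even , ascend h h≤L
    where
      h≤L : h ≤ L
      h≤L = subst (h ≤_) (sym L≡2h+1) (≤-trans (m≤m+n h h) (n≤1+n (h + h)))
      even : fromℕ< (carry<k (L ∸ h)) ≡ fromℕ< (carry<k (suc h))
      even = cong (λ i → fromℕ< (carry<k i))
               (trans (cong (_∸ h) L≡2h+1) (trans (+-∸-assoc 1 (m≤m+n h h)) (cong suc (m+n∸n≡m h h))))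

  -- The outer columns 0 and L say that the start node has an edge into node 1,
  -- labelled by the first and the last digit.
  start-labels : StartLabels g k (firstDigit M) (lastDigit M) (carry L) (carry 1)
  start-labels = A<g , a<g′ , M.lead≢0 , a≢0 , s₁ , s₂
    where
      A≡ : firstDigit M ≡ a L
      A≡ = last-digit M.digits
      a≡ : lastDigit M ≡ a 0
      a≡ = head-digit M.digits
      A<g : firstDigit M < g
      A<g = subst (_< g) (sym A≡) (a<g ≤-refl)
      a<g′ : lastDigit M < g
      a<g′ = subst (_< g) (sym a≡) (a<g z<s)
      s₁ : k * lastDigit M + 0 ≡ firstDigit M + carry 1 * g
      s₁ = subst₂ (λ x y → k * x + 0 ≡ y + carry 1 * g) (sym a≡) (sym A≡)
             (trans (cong (k * a 0 +_) (sym carry-first)) (column-j z≤n))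
      s₂ : k * firstDigit M + carry L ≡ lastDigit M + 0 * g
      s₂ = subst₂ (λ x y → k * y + carry L ≡ x + 0 * g) (sym a≡) (sym A≡)
             (trans (column-mirror z≤n) (cong (λ c → a 0 + c * g) carry-last))
      a≢0 : lastDigit M ≢ 0
      a≢0 a≡0
        with m*n≡0⇒m≡0∨n≡0 k (m+n≡0⇒m≡0 (k * firstDigit M) (trans s₂ (cong (_+ 0 * g) a≡0)))
      ... | inj₂ A≡0 = M.lead≢0 A≡0

  entry : ∃[ R ] ∃[ r ] (StartLabels g k (firstDigit M) (lastDigit M) (toℕ R) (toℕ r) × InY g k (nd R r))
  entry = R , r , labels , (_◅_ {j = node 1} (firstDigit M , lastDigit M , labels) ε , middle)
    where
      R r : Fin k
      R = fromℕ< (carry<k L)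
      r = fromℕ< (carry<k 1)
      labels : StartLabels g k (firstDigit M) (lastDigit M) (toℕ R) (toℕ r)
      labels = subst₂ (StartLabels g k (firstDigit M) (lastDigit M))
                 (sym (toℕ-fromℕ< (carry<k L))) (sym (toℕ-fromℕ< (carry<k 1))) start-labels

-- Edges of H((k+1)m, k), k = d+1: an edge [P,p] → [R,r] labelled (A,a)
-- forces R = p (reduce modulo k+1) and then d A + p = m (r + k P).
edge-shape : ∀ d m {A a P p R r} → p ≤ d → R ≤ d →
             suc d * a + p ≡ A + r * (suc (suc d) * m) →
             suc d * A + R ≡ a + P * (suc (suc d) * m) →
             R ≡ p × d * A + p ≡ m * (r + suc d * P)
edge-shape d m {A} {a} {P} {p} {R} {r} p≤d R≤d e₁ e₂ = R≡p , balance
  where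
    open ≡-Reasoning
    -- k(kA + R) + p computed in two ways, after adding R to both sides
    congruent : p + (d * A + R) * suc (suc d) ≡ R + m * (r + suc d * P) * suc (suc d)
    congruent = +-cancelˡ-≡ A _ _ (begin
      A + (p + (d * A + R) * suc (suc d))        ≡⟨ solve (d ∷ˡ A ∷ˡ R ∷ˡ p ∷ˡ []ˡ) ⟩
      suc d * (suc d * A + R) + p + R            ≡⟨ cong (λ x → suc d * x + p + R) e₂ ⟩
      suc d * (a + P * (suc (suc d) * m)) + p + R
        ≡⟨ solve (d ∷ˡ a ∷ˡ P ∷ˡ m ∷ˡ p ∷ˡ R ∷ˡ []ˡ) ⟩
      (suc d * a + p) + suc d * P * (suc (suc d) * m) + R
        ≡⟨ cong (λ x → x + suc d * P * (suc (suc d) * m) + R) e₁ ⟩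
      A + r * (suc (suc d) * m) + suc d * P * (suc (suc d) * m) + R
        ≡⟨ solve (d ∷ˡ A ∷ˡ r ∷ˡ m ∷ˡ P ∷ˡ R ∷ˡ []ˡ) ⟩
      A + (R + m * (r + suc d * P) * suc (suc d)) ∎)
    R≡p : R ≡ p
    R≡p = sym (residue-unique (suc (suc d)) (d * A + R) (m * (r + suc d * P))
                (s≤s (m≤n⇒m≤1+n p≤d)) (s≤s (m≤n⇒m≤1+n R≤d)) congruent)
    balance : d * A + p ≡ m * (r + suc d * P)
    balance = *-cancelʳ-≡ _ _ (suc (suc d)) (+-cancelˡ-≡ p _ _
                (trans (cong (λ x → p + (d * A + x) * suc (suc d)) (sym R≡p))
                       (trans congruent (cong (λ x → x + m * (r + suc d * P) * suc (suc d)) R≡p))))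

refine-divisor : ∀ {d m k c e G A P p r} → c * e ≡ d → G ∣ m → G ∣ e → c ∣ P → c ∣ r →
                 d * A + p ≡ m * (r + k * P) → c * G ∣ p
refine-divisor {d} {m} {k} {c} {e} {G} {A} {P} {p} {r} ce G∣m G∣e c∣P c∣r balance =
  ∣m+n∣m⇒∣n (subst (c * G ∣_) (sym balance) cG∣rhs) cG∣dA
  where
    cG∣dA : c * G ∣ d * A
    cG∣dA = ∣m⇒∣m*n A (subst (c * G ∣_) ce (*-monoʳ-∣ c G∣e))
    cG∣rhs : c * G ∣ m * (r + k * P)
    cG∣rhs = subst (_∣ m * (r + k * P)) (*-comm G c)
               (*-pres-∣ G∣m (∣m∣n⇒∣m+n c∣r (∣n⇒∣m*n k c∣P)))

saturate-divisor : ∀ {d m k c e A P p r} .{{_ : NonZero c}} → c * e ≡ d → Coprime e m →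
                   d ∣ P → d ∣ p → c ∣ r → d * A + p ≡ m * (r + k * P) → d ∣ r
saturate-divisor {d} {m} {k} {c} {e} {A} {P} {p} {r} ce e⊥m d∣P d∣p (divides r′ refl) balance =
  subst (_∣ r′ * c) ce (subst (c * e ∣_) (*-comm c r′) (*-monoʳ-∣ c e∣r′))
  where
    d∣mr : d ∣ m * (r′ * c)
    d∣mr = ∣m+n∣m⇒∣n d∣sum (∣n⇒∣m*n m (∣n⇒∣m*n k d∣P))
      where
        d∣sum : d ∣ m * (k * P) + m * (r′ * c)
        d∣sum = subst (d ∣_) (trans balance (trans (*-distribˡ-+ m (r′ * c) (k * P))
                                                   (+-comm (m * (r′ * c)) _)))
                  (∣m∣n⇒∣m+n (m∣m*n A) d∣p)
    e∣r′ : e ∣ r′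
    e∣r′ = coprime-divisor e⊥m (*-cancelˡ-∣ c (subst₂ _∣_ (sym ce) mr≡ d∣mr))
      where
        mr≡ : m * (r′ * c) ≡ c * (m * r′)
        mr≡ = solve (m ∷ˡ r′ ∷ˡ c ∷ˡ []ˡ)

-- The edge pattern between corners [x,y] → [y′,z] (coordinates 0 or d, coded
-- by Bools): the middle values must agree and may not form a swap, i.e. y
-- equals one of its neighbours.  From the start node only [0,d] is reached.
CornerEdge : Bool → Bool → Bool → Bool → Set
CornerEdge x y y′ z = y ≡ y′ × (x ≡ y ⊎ y ≡ z)

StartCorner : Bool → Bool → Set
StartCorner y z = y ≡ false × z ≡ true

-- Corner nodes: both coordinates are 0 or d = k-1, coded by Bools
-- (true meaning d).
module Levels (d′ : ℕ) where

  level : Bool → Fin (suc (suc d′))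
  level false = Fin.zero
  level true  = fromℕ (suc d′)

  height : Bool → ℕ
  height false = 0
  height true  = suc d′

  toℕ-level : ∀ b → toℕ (level b) ≡ height b
  toℕ-level false = refl
  toℕ-level true  = toℕ-fromℕ (suc d′)

  level-injective : ∀ {b b′} → level b ≡ level b′ → b ≡ b′
  level-injective {false} {false} _ = refl
  level-injective {true}  {true}  _ = refl

  corner : Bool → Bool → Node (suc (suc d′))
  corner b₁ b₂ = nd (level b₁) (level b₂)

isTop : ∀ {n} → Fin n → Bool
isTop Fin.zero    = false
isTop (Fin.suc _) = true

relabel : ∀ {n} d′ → Node n → Node (suc (suc d′))
relabel d′ start    = start
relabel d′ (nd P p) = Levels.corner d′ (isTop P) (isTop p)

relabel-corner : ∀ d₁ d₂ b₁ b₂ → relabel d₂ (Levels.corner d₁ b₁ b₂) ≡ Levels.corner d₂ b₁ b₂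
relabel-corner d₁ d₂ false false = refl
relabel-corner d₁ d₂ false true  = refl
relabel-corner d₁ d₂ true  false = refl
relabel-corner d₁ d₂ true  true  = refl

module Corner (d′ m′ : ℕ) where

  d k m g : ℕ
  d = suc d′
  k = suc d
  m = suc m′
  g = suc k * m

  open Levels d′ public

  -- The coordinates of a node; the start node counts as [0,0].
  coord₁ coord₂ : Node k → ℕ
  coord₁ start    = 0
  coord₁ (nd P _) = toℕ P
  coord₂ start    = 0
  coord₂ (nd _ p) = toℕ p

  edge-facts : ∀ {u R r} → Edge g k u (nd R r) →
               toℕ R ≡ coord₂ u × ∃[ A ] (d * A + coord₂ u ≡ m * (toℕ r + k * coord₁ u))
  edge-facts {start} {R} {r} (A , a , _ , _ , _ , _ , e₁ , e₂) =
    map₂ (A ,_) (edge-shape d m {A} {a} {0} {0} {toℕ R} {toℕ r} z≤n (toℕ≤pred[n] R) e₁ e₂)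
  edge-facts {nd P p} {R} {r} (A , a , _ , _ , e₁ , e₂) =
    map₂ (A ,_) (edge-shape d m {A} {a} {toℕ P} {toℕ p} {toℕ R} {toℕ r}
                            (toℕ≤pred[n] p) (toℕ≤pred[n] R) e₁ e₂)

  CoordsDivisible : ℕ → Node k → Set
  CoordsDivisible c v = c ∣ coord₁ v × c ∣ coord₂ v

  DividesY : ℕ → Set
  DividesY c = ∀ {v} → InY g k v → CoordsDivisible c v

  -- A first coordinate is the
  -- second coordinate of the predecessor; a second coordinate is controlled
  -- by the edge leaving the node (or it equals the first, at an even pivot).
  refine : ∀ {c e G} → c * e ≡ d → G ∣ m → G ∣ e → DividesY c → DividesY (c * G)
  refine {c} {e} {G} ce G∣m G∣e div {start}  _ = (c * G) ∣0 , (c * G) ∣0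
  refine {c} {e} {G} ce G∣m G∣e div {nd P p} y = cG∣P , cG∣p
    where
      lift : ∀ {u R r} → Edge g k u (nd R r) → c ∣ coord₁ u → c ∣ toℕ r → c * G ∣ coord₂ u
      lift edge c∣P c∣r =
        refine-divisor {d = d} {m = m} {k = k} {c = c} ce G∣m G∣e c∣P c∣r (proj₂ (proj₂ (edge-facts edge)))
      cG∣P : c * G ∣ toℕ P
      cG∣P with Y-entry y (λ ())
      ... | u , edge , yu = subst (c * G ∣_) (sym (proj₁ (edge-facts edge)))
                                  (lift edge (proj₁ (div yu)) (proj₂ (div y)))
      cG∣p : c * G ∣ toℕ p
      cG∣p with Y-exit y
      ... | inj₁ (inj₁ P≡p)              = subst (λ x → c * G ∣ toℕ x) P≡p cG∣P
      ... | inj₁ (inj₂ odd)              = lift odd (proj₁ (div y)) (proj₁ (div y))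
      ... | inj₂ (start    , () , _)
      ... | inj₂ (nd R r , edge , yt)    = lift edge (proj₁ (div y)) (proj₂ (div yt))

  -- Once the cofactor e = d / c is coprime to m, induction along Y from the
  -- start node shows that d itself divides all coordinates.
  saturate : ∀ {c e} → c * e ≡ d → Coprime e m → DividesY c → DividesY d
  saturate {c} {e} ce e⊥m div = Y-induction (CoordsDivisible d) (d ∣0 , d ∣0) step
    where
      instance
        c≢0 : NonZero c
        c≢0 = proj₁ (factors-nonZero ce)
      step : ∀ {u v} → InY g k v → Edge g k u v → CoordsDivisible d u → CoordsDivisible d v
      step {v = start}  _ ()
      step {v = nd R r} y edge (d∣P , d∣p) with edge-facts edge
      ... | R≡p , A , balance =
        subst (d ∣_) (sym R≡p) d∣p ,
        saturate-divisor {d = d} {m = m} {k = k} {c = c} ce e⊥m d∣P d∣p (proj₂ (div y)) balance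

  -- Starting from c = 1, refine by gcd(m, e) until the cofactor is coprime
  -- to m; the cofactor strictly decreases, so this terminates.
  divides-Y : DividesY d
  divides-Y = <-rec Goal step d (*-identityˡ d) (λ _ → 1∣ _ , 1∣ _)
    where
      Goal : ℕ → Set
      Goal e = ∀ {c} → c * e ≡ d → DividesY c → DividesY d
      step : ∀ e → (∀ {e′} → e′ < e → Goal e′) → Goal e
      step e rec {c} ce div with gcd m e ≟ 1
      ... | yes gcd≡1 = saturate ce (Coprimality.sym (gcd≡1⇒coprime gcd≡1)) div
      ... | no gcd≢1 with gcd[m,n]∣n m e
      ...   | divides e′ e≡e′G =
        rec e′<e cGe′≡d (refine {c = c} ce (gcd[m,n]∣m m e) (gcd[m,n]∣n m e) div)
        where
          G : ℕ
          G = gcd m e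
          e≢0 : e ≢ 0
          e≢0 = ≢-nonZero⁻¹ e {{proj₂ (factors-nonZero {c = c} ce)}}
          instance
            e′≢0 : NonZero e′
            e′≢0 = ≢-nonZero (λ e′≡0 → e≢0 (trans e≡e′G (cong (_* G) e′≡0)))
          e′<e : e′ < e
          e′<e = subst (e′ <_) (sym e≡e′G) (m<m*n e′ G (≢0∧≢1⇒>1 G≢0 gcd≢1))
            where
              G≢0 : G ≢ 0
              G≢0 G≡0 = e≢0 (trans e≡e′G (trans (cong (e′ *_) G≡0) (*-zeroʳ e′)))
          cGe′≡d : c * G * e′ ≡ d
          cGe′≡d = trans (*-assoc c G e′) (trans (cong (c *_) (trans (*-comm G e′) (sym e≡e′G))) ce)

  extreme : (x : Fin k) → d ∣ toℕ x → ∃[ b ] (x ≡ level b)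
  extreme x d∣x with toℕ x ≟ 0
  ... | yes x≡0 = false , toℕ-injective x≡0
  ... | no  x≢0 = true , toℕ-injective (trans x≡d (sym (toℕ-fromℕ d)))
    where
      x≡d : toℕ x ≡ d
      x≡d = ≤-antisym (toℕ≤pred[n] x) (∣⇒≤ {{≢-nonZero x≢0}} d∣x)

  data Shape : Node k → Set where
    start-shape  : Shape start
    corner-shape : ∀ b₁ b₂ → Shape (corner b₁ b₂)

  shape : ∀ {v} → InY g k v → Shape v
  shape {start}  _ = start-shape
  shape {nd P p} y with extreme P (proj₁ (divides-Y y)) | extreme p (proj₂ (divides-Y y))
  ... | b₁ , refl | b₂ , refl = corner-shape b₁ b₂

  corner-edge≡ : ∀ b₁ b₂ b₃ b₄ → Edge g k (corner b₁ b₂) (corner b₃ b₄) ≡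
                 EdgeFrom g k (height b₁) (height b₂) (height b₃) (height b₄)
  corner-edge≡ b₁ b₂ b₃ b₄
    rewrite toℕ-level b₁ | toℕ-level b₂ | toℕ-level b₃ | toℕ-level b₄ = refl

  start-edge≡ : ∀ b₁ b₂ → Edge g k start (corner b₁ b₂) ≡
                Σ ℕ λ A → Σ ℕ λ a → StartLabels g k A a (height b₁) (height b₂)
  start-edge≡ b₁ b₂ rewrite toℕ-level b₁ | toℕ-level b₂ = refl

  heights⇒edge : ∀ b₁ b₂ b₃ b₄ → EdgeFrom g k (height b₁) (height b₂) (height b₃) (height b₄) →
                 Edge g k (corner b₁ b₂) (corner b₃ b₄)
  heights⇒edge b₁ b₂ b₃ b₄ = subst id (sym (corner-edge≡ b₁ b₂ b₃ b₄))

  edge⇒heights : ∀ b₁ b₂ b₃ b₄ → Edge g k (corner b₁ b₂) (corner b₃ b₄) →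
                 EdgeFrom g k (height b₁) (height b₂) (height b₃) (height b₄)
  edge⇒heights b₁ b₂ b₃ b₄ = subst id (corner-edge≡ b₁ b₂ b₃ b₄)

  label<g : ∀ x y → g ≡ suc x + y → x < g
  label<g x y g≡ = subst (x <_) (sym g≡) (m≤m+n (suc x) y)

  flat : EdgeFrom g k 0 0 0 0
  flat = 0 , 0 , z<s , z<s , k0≡0 , k0≡0
    where
      k0≡0 : k * 0 + 0 ≡ 0
      k0≡0 = cong (_+ 0) (*-zeroʳ k)

  rise-labels : StartLabels g k m (k * m) 0 d
  rise-labels = m<m+n m z<s , m<n+m (k * m) z<s , (λ ()) , (λ ()) , rise-eq d m , refl
    where
      rise-eq : ∀ d m → suc d * (suc d * m) + 0 ≡ m + d * (suc (suc d) * m)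
      rise-eq = solve-∀

  rise : EdgeFrom g k 0 0 0 d
  rise with rise-labels
  ... | m<g , km<g , _ , _ , e₁ , e₂ = m , k * m , m<g , km<g , e₁ , e₂

  climb : EdgeFrom g k 0 d d d
  climb = m′ , k * m′ + d , <-trans (n<1+n m′) (m<m+n m z<s) ,
          label<g (k * m′ + d) m (bound d′ m′) , climb-eq d m′ , sym (+-identityʳ _)
    where
      bound : ∀ d′ m′ → suc (suc (suc d′)) * suc m′ ≡ suc (suc (suc d′) * m′ + suc d′) + suc m′
      bound = solve-∀
      climb-eq : ∀ d m′ → suc d * (suc d * m′ + d) + d ≡ m′ + d * (suc (suc d) * suc m′)
      climb-eq = solve-∀

  summit : EdgeFrom g k d d d d
  summit = g-1 , g-1 , g-1<g , g-1<g , summit-eq d m′ , summit-eq d m′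
    where
      g-1 : ℕ
      g-1 = k * m + m′
      g-1<g : g-1 < g
      g-1<g = label<g g-1 0 (bound d m′)
        where
          bound : ∀ d m′ → suc (suc d) * suc m′ ≡ suc (suc d * suc m′ + m′) + 0
          bound = solve-∀
      summit-eq : ∀ d m′ → suc d * (suc d * suc m′ + m′) + d ≡
                           (suc d * suc m′ + m′) + d * (suc (suc d) * suc m′)
      summit-eq = solve-∀

  -- The edge table of the corners: the allowed edges are the basic ones and
  -- their reversals; conversely the middle values agree by edge-facts, and
  -- the two swaps are excluded by no-swap-up and no-swap-down.
  corner-edge⇐ : ∀ x y y′ z → CornerEdge x y y′ z → Edge g k (corner x y) (corner y′ z)
  corner-edge⇐ false false .false false (refl , _) = heights⇒edge false false false false flat
  corner-edge⇐ false false .false true  (refl , _) = heights⇒edge false false false true rise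
  corner-edge⇐ false true  .true  true  (refl , _) = heights⇒edge false true true true climb
  corner-edge⇐ true  false .false false (refl , _) =
    heights⇒edge true false false false (edge-reverse {g} {k} {0} {0} {0} {d} rise)
  corner-edge⇐ true  true  .true  false (refl , _) =
    heights⇒edge true true true false (edge-reverse {g} {k} {0} {d} {d} {d} climb)
  corner-edge⇐ true  true  .true  true  (refl , _) = heights⇒edge true true true true summit
  corner-edge⇐ false true  .true  false (refl , inj₁ ())
  corner-edge⇐ false true  .true  false (refl , inj₂ ())
  corner-edge⇐ true  false .false true  (refl , inj₁ ())
  corner-edge⇐ true  false .false true  (refl , inj₂ ())

  corner-edge⇒ : ∀ x y y′ z → Edge g k (corner x y) (corner y′ z) → CornerEdge x y y′ z
  corner-edge⇒ x y y′ z edge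
    with level-injective {y′} {y} (toℕ-injective (proj₁ (edge-facts {corner x y} {level y′} {level z} edge)))
  ... | refl = refl , no-swap x y z edge
    where
      no-swap : ∀ x y z → Edge g k (corner x y) (corner y z) → x ≡ y ⊎ y ≡ z
      no-swap false false _     _    = inj₁ refl
      no-swap true  true  _     _    = inj₁ refl
      no-swap false true  true  _    = inj₂ refl
      no-swap true  false false _    = inj₂ refl
      no-swap false true  false edge = ⊥-elim (no-swap-up {g} {d} {d} z<s (edge⇒heights false true true false edge))
      no-swap true  false true  edge = ⊥-elim (no-swap-down {d′ = d′} (edge⇒heights true false false true edge))

  start-edge⇐ : ∀ y z → StartCorner y z → Edge g k start (corner y z)
  start-edge⇐ .false .true (refl , refl) =
    subst id (sym (start-edge≡ false true)) (m , k * m , rise-labels)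

  -- Nothing leaves the start node towards [d,_] (edge-facts) or [0,0]
  -- (start-edge-r≢0).
  start-edge⇒ : ∀ y z → Edge g k start (corner y z) → StartCorner y z
  start-edge⇒ y z edge
    with level-injective {y} {false} (toℕ-injective (proj₁ (edge-facts {start} {level y} {level z} edge)))
  start-edge⇒ .false false (A , a , _ , _ , _ , a≢0 , e₁ , e₂) | refl =
    ⊥-elim (start-edge-r≢0 {g = g} {k′ = d′} a≢0 e₁ e₂)
  start-edge⇒ .false true _ | refl = refl , refl

  -- The path start → [0,d] → [d,d] → [d,0] → [0,0] visits every corner,
  -- and [d,d] and [0,0] are even pivots; hence Y contains all of them.
  corner-step : ∀ x y z → x ≡ y ⊎ y ≡ z → Star (Edge g k) (corner x y) (corner y z)
  corner-step x y z c = _◅_ {j = corner y z} (corner-edge⇐ x y y z (refl , c)) ε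

  enter : Star (Edge g k) start (corner false true)
  enter = _◅_ {j = corner false true} (start-edge⇐ false true (refl , refl)) ε

  up : Star (Edge g k) (corner false true) (corner true true)
  up = corner-step false true true (inj₂ refl)

  over : Star (Edge g k) (corner true true) (corner true false)
  over = corner-step true true false (inj₁ refl)

  down : Star (Edge g k) (corner true false) (corner false false)
  down = corner-step true false false (inj₂ refl)

  start-inY : InY g k start
  start-inY = ε , corner true true , inj₁ refl , enter ◅◅ up

  corner-inY : ∀ b₁ b₂ → InY g k (corner b₁ b₂)
  corner-inY false true  = enter , corner true true , inj₁ refl , up
  corner-inY true  true  = enter ◅◅ up , corner true true , inj₁ refl , ε
  corner-inY true  false = enter ◅◅ up ◅◅ over , corner false false , inj₁ refl , down
  corner-inY false false = enter ◅◅ up ◅◅ over ◅◅ down , corner false false , inj₁ refl , ε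

  start-successor : ∀ {v} → InY g k v → Edge g k start v → v ≡ corner false true
  start-successor y edge with shape y
  ... | start-shape        = ⊥-elim edge
  ... | corner-shape b₁ b₂ = entry (start-edge⇒ b₁ b₂ edge)
    where
      entry : ∀ {y z} → StartCorner y z → corner y z ≡ corner false true
      entry (refl , refl) = refl

module Transfer (d₁ m₁ d₂ m₂ : ℕ) where
  private
    module Y₁ = Corner d₁ m₁
    module Y₂ = Corner d₂ m₂

  map : Node Y₁.k → Node Y₂.k
  map = relabel d₂

  map-Y : ∀ {v} → InY Y₁.g Y₁.k v → InY Y₂.g Y₂.k (map v)
  map-Y y with Y₁.shape y
  ... | Y₁.start-shape       = Y₂.start-inY
  ... | Y₁.corner-shape b₁ b₂ =
    subst (InY Y₂.g Y₂.k) (sym (relabel-corner d₁ d₂ b₁ b₂)) (Y₂.corner-inY b₁ b₂)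

  round-trip : ∀ {v} → InY Y₁.g Y₁.k v → relabel d₁ (map v) ≡ v
  round-trip y with Y₁.shape y
  ... | Y₁.start-shape        = refl
  ... | Y₁.corner-shape b₁ b₂ =
    trans (cong (relabel d₁) (relabel-corner d₁ d₂ b₁ b₂)) (relabel-corner d₂ d₁ b₁ b₂)

  map-edge : ∀ {u v} → InY Y₁.g Y₁.k u → InY Y₁.g Y₁.k v →
             Edge Y₁.g Y₁.k u v → Edge Y₂.g Y₂.k (map u) (map v)
  map-edge yu yv edge with Y₁.shape yu | Y₁.shape yv
  ... | _                    | Y₁.start-shape       = ⊥-elim edge
  ... | Y₁.start-shape       | Y₁.corner-shape y z  =
    subst (Edge Y₂.g Y₂.k start) (sym (relabel-corner d₁ d₂ y z))
      (Y₂.start-edge⇐ y z (Y₁.start-edge⇒ y z edge))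
  ... | Y₁.corner-shape x y  | Y₁.corner-shape y′ z =
    subst₂ (Edge Y₂.g Y₂.k) (sym (relabel-corner d₁ d₂ x y)) (sym (relabel-corner d₁ d₂ y′ z))
      (Y₂.corner-edge⇐ x y y′ z (Y₁.corner-edge⇒ x y y′ z edge))

  map-even : ∀ {v} → InY Y₁.g Y₁.k v → EvenPivot v → EvenPivot (map v)
  map-even y even with Y₁.shape y
  ... | Y₁.start-shape        = even
  ... | Y₁.corner-shape b₁ b₂ =
    subst EvenPivot (sym (relabel-corner d₁ d₂ b₁ b₂)) (cong Y₂.level (Y₁.level-injective {b₁} {b₂} even))

  map-odd : ∀ {v} → InY Y₁.g Y₁.k v → OddPivot Y₁.g Y₁.k v → OddPivot Y₂.g Y₂.k (map v)
  map-odd y odd with Y₁.shape y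
  ... | Y₁.start-shape        = odd
  ... | Y₁.corner-shape b₁ b₂ =
    subst (OddPivot Y₂.g Y₂.k) (sym (relabel-corner d₁ d₂ b₁ b₂))
      (Y₂.corner-edge⇐ b₁ b₂ b₂ b₁ (Y₁.corner-edge⇒ b₁ b₂ b₂ b₁ odd))

-- Y((k+1)m, k) is a 1089 graph for all k ≥ 2 and m ≥ 1, since Y(10,9) is the
-- corner graph with k = 9, m = 1: relabelling in both directions is the
-- isomorphism.
corner-1089 : ∀ d′ m′ → Is1089Graph (Corner.g d′ m′) (Corner.k d′ m′)
corner-1089 d′ m′ = record
  { to      = There.map
  ; from    = Back.map
  ; to-Y    = λ _ → There.map-Y
  ; from-Y  = λ _ → Back.map-Y
  ; from-to = λ _ → There.round-trip
  ; to-from = λ _ → Back.round-trip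
  ; edges   = λ u v yu yv → mk⇔ (There.map-edge yu yv) (pull-back yu yv)
  ; even    = λ v y → mk⇔ (There.map-even y)
                          (λ e → subst EvenPivot (There.round-trip y) (Back.map-even (There.map-Y y) e))
  ; odd     = λ v y → mk⇔ (There.map-odd y)
                          (λ o → subst (OddPivot _ _) (There.round-trip y) (Back.map-odd (There.map-Y y) o))
  }
  where
    module There = Transfer d′ m′ 7 0
    module Back  = Transfer 7 0 d′ m′
    pull-back : ∀ {u v} → InY (Corner.g d′ m′) (Corner.k d′ m′) u →
                InY (Corner.g d′ m′) (Corner.k d′ m′) v →
                Edge 10 9 (There.map u) (There.map v) → Edge (Corner.g d′ m′) (Corner.k d′ m′) u v
    pull-back yu yv e =
      subst₂ (Edge _ _) (There.round-trip yu) (There.round-trip yv)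
        (Back.map-edge (There.map-Y yu) (There.map-Y yv) e)

-- Y(10,9) is the corner graph with k = 9 and m = 1.
module Ten = Corner 7 0

-- An isomorphism onto Y(10,9) fixes the start node: nothing enters the start
-- node, whereas every corner [b₁,b₂] has the predecessor [b₁,b₁].
iso-fixes-start : ∀ {g k} (I : Is1089Graph g k) → InY g k start →
                  Is1089Graph.to I start ≡ start
iso-fixes-start {g} {k} I start-Y = fixed (I.to start) (I.to-Y start start-Y) refl
  where
    module I = Is1089Graph I
    fixed : ∀ v → InY 10 9 v → I.to start ≡ v → v ≡ start
    fixed v yv eq with Ten.shape yv
    ... | Ten.start-shape        = refl
    ... | Ten.corner-shape b₁ b₂ = ⊥-elim (Equivalence.from (I.edges u start yu start-Y) into-start)
      where
        u : Node k
        u = I.from (Ten.corner b₁ b₁)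
        yu : InY g k u
        yu = I.from-Y _ (Ten.corner-inY b₁ b₁)
        into-start : Edge 10 9 (I.to u) (I.to start)
        into-start = subst₂ (Edge 10 9) (sym (I.to-from _ (Ten.corner-inY b₁ b₁))) (sym eq)
                       (Ten.corner-edge⇐ b₁ b₁ b₁ b₂ (refl , inj₁ refl))

-- In a 1089 graph, a successor w of the start node lying in Y corresponds to
-- [0,8]: so w is not an odd pivot, and it has an edge to an even pivot x
-- (corresponding to [8,8]) that carries a loop.
successor-structure : ∀ {g k} → Is1089Graph g k → ∀ {w} → Edge g k start w → InY g k w →
                      ¬ OddPivot g k w × ∃[ x ] (EvenPivot x × Edge g k w x × Edge g k x x)
successor-structure {g} {k} I {w} e₀ y@(_ , w′ , piv , path) =
  not-odd , x , even-x , edge-x , loop-x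
  where
    module I = Is1089Graph I
    start-Y : InY g k start
    start-Y = ε , w′ , piv , _◅_ {j = w} e₀ path

    to-w : I.to w ≡ Ten.corner false true
    to-w = Ten.start-successor (I.to-Y w y)
             (subst (λ v → Edge 10 9 v (I.to w)) (iso-fixes-start I start-Y)
                    (Equivalence.to (I.edges start w start-Y y) e₀))

    not-odd : ¬ OddPivot g k w
    not-odd o with Ten.corner-edge⇒ false true true false
                     (subst (OddPivot 10 9) to-w (Equivalence.to (I.odd w y) o))
    ... | refl , inj₁ ()
    ... | refl , inj₂ ()

    top : Node 9
    top = Ten.corner true true
    x : Node k
    x = I.from top
    yx : InY g k x
    yx = I.from-Y top (Ten.corner-inY true true)
    to-x : I.to x ≡ top
    to-x = I.to-from top (Ten.corner-inY true true)

    even-x : EvenPivot x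
    even-x = Equivalence.from (I.even x yx) (subst EvenPivot (sym to-x) refl)
    edge-x : Edge g k w x
    edge-x = Equivalence.from (I.edges w x y yx)
      (subst₂ (Edge 10 9) (sym to-w) (sym to-x) (Ten.corner-edge⇐ false true true true (refl , inj₂ refl)))
    loop-x : Edge g k x x
    loop-x = Equivalence.from (I.edges x x yx yx)
      (subst₂ (Edge 10 9) (sym to-x) (sym to-x) (Ten.corner-edge⇐ true true true true (refl , inj₁ refl)))

start-sum⇒g≡[k+1]A : ∀ {g d A a R r} → r ≤ d → A + a ≡ g →
                     suc d * a + 0 ≡ A + r * g → suc d * A + R ≡ a + 0 * g →
                     g ≡ suc (suc d) * A
start-sum⇒g≡[k+1]A {A = A} {a} {R} {r} r≤d refl e₁ e₂
  with m≤n⇒∃[o]m+o≡n r≤d | sym (trans e₂ (+-identityʳ a))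
... | t , refl | refl = trans (cong (λ x → A + (suc (r + t) * A + x)) R≡0) (cong (A +_) (+-identityʳ _))
  where
    open ≡-Reasoning
    -- expanding k a = A + r g with a = kA + R, g = A + a leaves a surplus
    surplus≡0 : t * (t + r + 2) * A + suc t * R ≡ 0
    surplus≡0 = +-cancelˡ-≡ (A + r * (A + (suc (r + t) * A + R))) _ _ (begin
      A + r * (A + (suc (r + t) * A + R)) + (t * (t + r + 2) * A + suc t * R)
        ≡⟨ solve (A ∷ˡ R ∷ˡ r ∷ˡ t ∷ˡ []ˡ) ⟩
      suc (r + t) * (suc (r + t) * A + R) + 0
        ≡⟨ e₁ ⟩
      A + r * (A + (suc (r + t) * A + R))
        ≡⟨ +-identityʳ _ ⟨
      A + r * (A + (suc (r + t) * A + R)) + 0 ∎)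
    R≡0 : R ≡ 0
    R≡0 = m*n≡0⇒m≡0 R (suc t) (trans (*-comm R (suc t)) (m+n≡0⇒n≡0 (t * (t + r + 2) * A) surplus≡0))

-- Conversely, the labels of a start edge into [0,k-1] add up to g:
-- here a = kA and k·kA = A + (k-1)g, i.e. (k-1)(A + kA) = (k-1)g.
start-edge-0d⇒sum : ∀ {g d′ A a} →
                    suc (suc d′) * a + 0 ≡ A + suc d′ * g →
                    suc (suc d′) * A + 0 ≡ a + 0 * g → A + a ≡ g
start-edge-0d⇒sum {g} {d′} {A} {a} e₁ e₂ with sym (trans e₂ (+-identityʳ a))
... | refl = *-cancelˡ-≡ _ _ (suc d′) (+-cancelˡ-≡ A _ _ (begin
  A + suc d′ * (A + (suc (suc d′) * A + 0)) ≡⟨ solve (A ∷ˡ d′ ∷ˡ []ˡ) ⟩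
  suc (suc d′) * (suc (suc d′) * A + 0) + 0 ≡⟨ e₁ ⟩
  A + suc d′ * g                            ∎))
  where open ≡-Reasoning

-- The two labels of a loop at [X,X] agree, so the loop says kC + X = C + Xg.
loop-balance : ∀ {g k X} → EdgeFrom g k X X X X → ∃[ C ] (C < g × k * C + X ≡ C + X * g)
loop-balance {g} {k} {X} (C , c , C<g , _ , e₁ , e₂) =
  C , C<g , subst (λ y → k * C + X ≡ y + X * g) c≡C e₂
  where
    open ≡-Reasoning
    c≡C : c ≡ C
    c≡C = *-cancelˡ-≡ c C (suc k) (+-cancelʳ-≡ (X + X * g) _ _ (begin
      suc k * c + (X + X * g)   ≡⟨ solve (c ∷ˡ k ∷ˡ X ∷ˡ g ∷ˡ []ˡ) ⟩
      (k * c + X) + (c + X * g) ≡⟨ cong₂ _+_ e₁ (sym e₂) ⟩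
      (C + X * g) + (k * C + X) ≡⟨ solve (C ∷ˡ k ∷ˡ X ∷ˡ g ∷ˡ []ˡ) ⟩
      suc k * C + (X + X * g)   ∎))

path-balance : ∀ {g d R r X C} → EdgeFrom g (suc d) R r X X → suc d * C + X ≡ C + X * g →
               ∃[ T ] (d * T + r ≡ d * C + R * g)
path-balance {g} {d} {R} {r} {X} {C} (B , b , _ , _ , e₁ , e₂) loop =
  b + B , +-cancelʳ-≡ (b + B + C + X + X * g) _ _ (begin
    d * (b + B) + r + (b + B + C + X + X * g)
      ≡⟨ solve (d ∷ˡ b ∷ˡ B ∷ˡ r ∷ˡ C ∷ˡ X ∷ˡ g ∷ˡ []ˡ) ⟩
    (suc d * b + r) + (suc d * B + X) + (C + X * g)
      ≡⟨ cong₂ _+_ (cong₂ _+_ e₁ e₂) (sym loop) ⟩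
    (B + X * g) + (b + R * g) + (suc d * C + X)
      ≡⟨ solve (d ∷ˡ b ∷ˡ B ∷ˡ R ∷ˡ C ∷ˡ X ∷ˡ g ∷ˡ []ˡ) ⟩
    d * C + R * g + (b + B + C + X + X * g) ∎)
  where open ≡-Reasoning

-- [R,r] is an odd pivot as soon as d D + r = R g for some D < g
-- (the edge [R,r] → [r,R] is labelled (D,D)).
balanced⇒odd : ∀ {g d R r D} → D < g → d * D + r ≡ R * g → EdgeFrom g (suc d) R r r R
balanced⇒odd {g} {d} {R} {r} {D} D<g eq = D , D , D<g , D<g , e , e
  where
    e : suc d * D + r ≡ D + R * g
    e = trans (+-assoc D _ _) (cong (D +_) eq)

-- If C ≤ T, the excess D = T - C
-- satisfies d D + r = R g, which makes [R,r] an odd pivot: D ≥ g would force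
-- r = 0, which start edges avoid.
excess⇒odd : ∀ {g d′ A a R r C D T} → R ≤ suc d′ → a ≢ 0 →
             suc (suc d′) * a + 0 ≡ A + r * g → suc (suc d′) * A + R ≡ a + 0 * g →
             C + D ≡ T → suc d′ * T + r ≡ suc d′ * C + R * g →
             EdgeFrom g (suc (suc d′)) R r r R
excess⇒odd {g} {d′} {A} {a} {R} {r} {C} {D} R≤d a≢0 s₁ s₂ refl balance = by-size (D <? g)
  where
    excess : suc d′ * D + r ≡ R * g
    excess = +-cancelˡ-≡ (suc d′ * C) _ _ (begin
      suc d′ * C + (suc d′ * D + r) ≡⟨ solve (d′ ∷ˡ C ∷ˡ D ∷ˡ r ∷ˡ []ˡ) ⟩
      suc d′ * (C + D) + r          ≡⟨ balance ⟩
      suc d′ * C + R * g            ∎)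
      where open ≡-Reasoning
    by-size : Dec (D < g) → EdgeFrom g (suc (suc d′)) R r r R
    by-size (yes D<g) = balanced⇒odd {d = suc d′} {R = R} D<g excess
    by-size (no  D≮g) =
      ⊥-elim (start-edge-r≢0 {g = g} {k′ = d′} a≢0 (subst (λ x → _ ≡ A + x * g) r≡0 s₁) s₂)
      where
        open ≤-Reasoning
        r≡0 : r ≡ 0
        r≡0 = n≤0⇒n≡0 (+-cancelˡ-≤ (suc d′ * g) r 0 (begin
          suc d′ * g + r ≤⟨ +-monoˡ-≤ r (*-monoʳ-≤ (suc d′) (≮⇒≥ D≮g)) ⟩
          suc d′ * D + r ≡⟨ excess ⟩
          R * g          ≤⟨ *-monoˡ-≤ g R≤d ⟩
          suc d′ * g     ≡⟨ +-identityʳ _ ⟨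
          suc d′ * g + 0 ∎))

-- If T < C, the balance gives r = d(o+1) + R g with C = T + o + 1; as r ≤ d,
-- this forces [R,r] = [0,d], so A + a = g by start-edge-0d⇒sum.
deficit⇒sum : ∀ {g d′ A a R r C T o} → r ≤ suc d′ → 0 < g →
              suc (suc d′) * a + 0 ≡ A + r * g → suc (suc d′) * A + R ≡ a + 0 * g →
              suc T + o ≡ C → suc d′ * T + r ≡ suc d′ * C + R * g → A + a ≡ g
deficit⇒sum {g} {d′} {A} {a} {R} {r} {C} {T} {o} r≤d g>0 s₁ s₂ refl balance =
  start-edge-0d⇒sum {d′ = d′} (subst (λ x → _ ≡ A + x * g) r≡d s₁)
                              (subst (λ x → _ + x ≡ _) R≡0 s₂)
  where
    deficit : r ≡ suc d′ + (suc d′ * o + R * g)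
    deficit = +-cancelˡ-≡ (suc d′ * T) _ _ (begin
      suc d′ * T + r                               ≡⟨ balance ⟩
      suc d′ * (suc T + o) + R * g                 ≡⟨ solve (d′ ∷ˡ T ∷ˡ o ∷ˡ R ∷ˡ g ∷ˡ []ˡ) ⟩
      suc d′ * T + (suc d′ + (suc d′ * o + R * g)) ∎)
      where open ≡-Reasoning
    rest≡0 : suc d′ * o + R * g ≡ 0
    rest≡0 = n≤0⇒n≡0 (+-cancelˡ-≤ (suc d′) _ 0
      (≤-trans (≤-reflexive (sym deficit)) (≤-trans r≤d (≤-reflexive (sym (+-identityʳ _))))))
    r≡d : r ≡ suc d′
    r≡d = trans deficit (trans (cong (suc d′ +_) rest≡0) (+-identityʳ _))
    R≡0 : R ≡ 0
    R≡0 = m*n≡0⇒m≡0 R g {{>-nonZero g>0}} (m+n≡0⇒n≡0 (suc d′ * o) rest≡0)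

labels-sum-to-g : ∀ {g d′ A a R r X} → R ≤ suc d′ → r ≤ suc d′ → a ≢ 0 →
                  suc (suc d′) * a + 0 ≡ A + r * g → suc (suc d′) * A + R ≡ a + 0 * g →
                  EdgeFrom g (suc (suc d′)) R r X X → EdgeFrom g (suc (suc d′)) X X X X →
                  ¬ EdgeFrom g (suc (suc d′)) R r r R → A + a ≡ g
labels-sum-to-g {g} {d′} {A} {a} {R} {r} R≤d r≤d a≢0 s₁ s₂ edge loop not-odd
  with loop-balance {k = suc (suc d′)} loop
... | C , C<g , loopC with path-balance {d = suc d′} {R = R} edge loopC
... | T , balance with C ≤? T
...   | yes C≤T =
  ⊥-elim (not-odd (excess⇒odd R≤d a≢0 s₁ s₂ (proj₂ (m≤n⇒∃[o]m+o≡n C≤T)) balance))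
...   | no  C≰T =
  deficit⇒sum r≤d (≤-<-trans z≤n C<g) s₁ s₂ (proj₂ (m≤n⇒∃[o]m+o≡n (≰⇒> C≰T))) balance

corollary4 : ∀ (g k : ℕ) → 2 ≤ k → k < g →
    ((Σ[ M ∈ ReverseMultiple g k ] (firstDigit M + lastDigit M ≡ g)) → Is1089Graph g k)
    × (Is1089Graph g k → ∀ (M : ReverseMultiple g k) → firstDigit M + lastDigit M ≡ g)
corollary4 (suc g′) (suc (suc d′)) (s≤s (s≤s z≤n)) (s≤s _) = sum⇒1089 , 1089⇒sum
  where
    -- digits adding up to g force g = (k+1)A with A ≥ 1, and then Y(g,k) is a
    -- corner graph
    sum⇒1089 : Σ[ M ∈ ReverseMultiple (suc g′) (suc (suc d′)) ] (firstDigit M + lastDigit M ≡ suc g′) →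
               Is1089Graph (suc g′) (suc (suc d′))
    sum⇒1089 (M , sum) with Walk.entry M
    ... | R , r , (_ , _ , A≢0 , _ , s₁ , s₂) , _ =
      corner-case (firstDigit M) A≢0 (start-sum⇒g≡[k+1]A (toℕ≤pred[n] r) sum s₁ s₂)
      where
        corner-case : ∀ A → A ≢ 0 → suc g′ ≡ suc (suc (suc d′)) * A →
                      Is1089Graph (suc g′) (suc (suc d′))
        corner-case zero     A≢0 _  = ⊥-elim (A≢0 refl)
        corner-case (suc m′) _   g≡ =
          subst (λ x → Is1089Graph x (suc (suc d′))) (sym g≡) (corner-1089 d′ m′)

    -- in a 1089 graph, the first edge of the walk of M has the shape that
    -- forces its labels to add up to g
    1089⇒sum : Is1089Graph (suc g′) (suc (suc d′)) → ∀ (M : ReverseMultiple (suc g′) (suc (suc d′))) →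
               firstDigit M + lastDigit M ≡ suc g′
    1089⇒sum I M with Walk.entry M
    ... | R , r , labels@(_ , _ , _ , a≢0 , s₁ , s₂) , y
      with successor-structure I (firstDigit M , lastDigit M , labels) y
    ...   | not-odd , nd X .X , refl , edge , loop =
      labels-sum-to-g (toℕ≤pred[n] R) (toℕ≤pred[n] r) a≢0 s₁ s₂ edge loop not-odd
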